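{- There exist countable incompressible dynamical systems $\langle\mathbb A,\alpha\rangle$ and $\langle\mathbb B,\beta\rangle$, an embedding $\iota$ of $\langle\mathbb A,\alpha\rangle$ into $\langle\mathbb B,\beta\rangle$, and an embedding $\eta$ of $\langle\mathbb A,\alpha\rangle$ into $\langle\mathcal P(\omega)/\mathrm{Fin},\sigma\rangle$, such that there is no embedding $\bar\eta$ of $\langle\mathbb B,\beta\rangle$ into $\langle\mathcal P(\omega)/\mathrm{Fin},\sigma\rangle$ with $\bar\eta\circ\iota=\eta$.
   Context: $\mathcal P(\omega)/\mathrm{Fin}$ is $\mathcal P(\omega)$ modulo finite sets, $[A]$ the class of $A$, and $\sigma([A])=[A+1]$ the shift automorphism. A dynamical system is a pair $\langle\mathbb A,\alpha\rangle$ with $\mathbb A$ a Boolean algebra and $\alpha$ an automorphism of $\mathbb A$. An embedding of $\langle\mathbb A,\alpha\rangle$ into $\langle\mathbb B,\beta\rangle$ is an injective Boolean homomorphism $\eta:\mathbb A\to\mathbb B$ with $\eta\circ\alpha=\beta\circ\eta$. A system $\langle\mathbb A,\alpha\rangle$ is incompressible if there is no $x\in\mathbb A\setminus\{\mathbf 0,\mathbf 1\}$ with $\alpha(x)\le x$. -}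

module Defs where

open import Level using (Level; 0ℓ)
open import Data.Nat using (ℕ; zero; suc; _≤_; _⊔_)
open import Data.Nat.Properties using (≤-refl; ≤-trans; m≤m⊔n; m≤n⊔m)
open import Data.Bool using (Bool; true; false; not) renaming (_∧_ to _∧ᵇ_; _∨_ to _∨ᵇ_)
import Data.Bool.Properties as BP
open import Data.Product using (Σ; _×_; _,_; proj₁; proj₂)
open import Data.Sum using (_⊎_)
open import Relation.Nullary using (¬_)
open import Relation.Binary.PropositionalEquality as Eq using (_≡_; refl; cong; cong₂)
open import Relation.Binary.Structures using (IsEquivalence)
open import Algebra.Lattice.Structures
open import Algebra.Lattice.Bundles using (BooleanAlgebra)

-- P(ω)/Fin, presented as a setoid: subsets of ω are ℕ → Bool
-- (characteristic functions), identified when they agree on a cofinite set.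

Subset : Set
Subset = ℕ → Bool

_=*_ : Subset → Subset → Set
A =* B = Σ ℕ λ N → ∀ n → N ≤ n → A n ≡ B n

private
  pw : {A B : Subset} → (∀ n → A n ≡ B n) → A =* B
  pw p = 0 , λ n _ → p n

  =*-equiv : IsEquivalence _=*_
  =*-equiv = record
    { refl  = 0 , λ _ _ → refl
    ; sym   = λ { (N , p) → N , λ n h → Eq.sym (p n h) }
    ; trans = λ { (N , p) (M , q) → N ⊔ M , λ n h →
                    Eq.trans (p n (≤-trans (m≤m⊔n N M) h)) (q n (≤-trans (m≤n⊔m N M) h)) }
    }

  cong₂* : (f : Bool → Bool → Bool) {A A' B B' : Subset} →
           A =* A' → B =* B' → (λ n → f (A n) (B n)) =* (λ n → f (A' n) (B' n))
  cong₂* f (N , p) (M , q) = N ⊔ M , λ n h →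
    cong₂ f (p n (≤-trans (m≤m⊔n N M) h)) (q n (≤-trans (m≤n⊔m N M) h))

_∪_ _∩_ : Subset → Subset → Subset
(A ∪ B) n = A n ∨ᵇ B n
(A ∩ B) n = A n ∧ᵇ B n

∁ : Subset → Subset
∁ A n = not (A n)

∅ ω : Subset
∅ _ = false
ω _ = true

PωFin : BooleanAlgebra 0ℓ 0ℓ
PωFin = record
  { Carrier = Subset
  ; _≈_ = _=*_
  ; _∨_ = _∪_
  ; _∧_ = _∩_
  ; ¬_ = ∁
  ; ⊤ = ω
  ; ⊥ = ∅
  ; isBooleanAlgebra = record
    { isDistributiveLattice = record
      { isLattice = record
        { isEquivalence = =*-equiv
        ; ∨-comm = λ A B → pw λ n → BP.∨-comm (A n) (B n)
        ; ∨-assoc = λ A B C → pw λ n → BP.∨-assoc (A n) (B n) (C n)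
        ; ∨-cong = cong₂* _∨ᵇ_
        ; ∧-comm = λ A B → pw λ n → BP.∧-comm (A n) (B n)
        ; ∧-assoc = λ A B C → pw λ n → BP.∧-assoc (A n) (B n) (C n)
        ; ∧-cong = cong₂* _∧ᵇ_
        ; absorptive = (λ A B → pw λ n → proj₁ BP.∨-∧-absorptive (A n) (B n))
                     , (λ A B → pw λ n → proj₂ BP.∨-∧-absorptive (A n) (B n))
        }
      ; ∨-distrib-∧ = (λ A B C → pw λ n → proj₁ BP.∨-distrib-∧ (A n) (B n) (C n))
                    , (λ A B C → pw λ n → proj₂ BP.∨-distrib-∧ (A n) (B n) (C n))
      ; ∧-distrib-∨ = (λ A B C → pw λ n → proj₁ BP.∧-distrib-∨ (A n) (B n) (C n))
                    , (λ A B C → pw λ n → proj₂ BP.∧-distrib-∨ (A n) (B n) (C n))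
      }
    ; ∨-complement = (λ A → pw λ n → proj₁ BP.∨-inverse (A n))
                   , (λ A → pw λ n → proj₂ BP.∨-inverse (A n))
    ; ∧-complement = (λ A → pw λ n → proj₁ BP.∧-inverse (A n))
                   , (λ A → pw λ n → proj₂ BP.∧-inverse (A n))
    ; ¬-cong = λ { (N , p) → N , λ n h → cong not (p n h) }
    }
  }

σ : Subset → Subset
σ A zero    = false
σ A (suc n) = A n

module _ {a ℓ b ℓ' : Level} (𝔸 : BooleanAlgebra a ℓ) (𝔹 : BooleanAlgebra b ℓ') where
  private
    module A = BooleanAlgebra 𝔸
    module B = BooleanAlgebra 𝔹

  record IsBAHom (f : A.Carrier → B.Carrier) : Set (a Level.⊔ ℓ Level.⊔ b Level.⊔ ℓ') where
    field
      cong-≈  : ∀ {x y} → x A.≈ y → f x B.≈ f y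
      hom-∨   : ∀ x y → f (x A.∨ y) B.≈ (f x B.∨ f y)
      hom-∧   : ∀ x y → f (x A.∧ y) B.≈ (f x B.∧ f y)
      hom-¬   : ∀ x → f (A.¬ x) B.≈ B.¬ (f x)
      hom-⊤   : f A.⊤ B.≈ B.⊤
      hom-⊥   : f A.⊥ B.≈ B.⊥

  record IsBAEmbedding (f : A.Carrier → B.Carrier) : Set (a Level.⊔ ℓ Level.⊔ b Level.⊔ ℓ') where
    field
      isHom     : IsBAHom f
      injective : ∀ {x y} → f x B.≈ f y → x A.≈ y

module _ {a ℓ : Level} (𝔸 : BooleanAlgebra a ℓ) where
  open BooleanAlgebra 𝔸

  record IsAutomorphism (α : Carrier → Carrier) : Set (a Level.⊔ ℓ) where
    field
      isEmbedding : IsBAEmbedding 𝔸 𝔸 α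
      surjective  : ∀ y → Σ Carrier λ x → α x ≈ y

  _≤ᴮ_ : Carrier → Carrier → Set ℓ
  x ≤ᴮ y = (x ∧ y) ≈ x

  Countable : Set (a Level.⊔ ℓ)
  Countable = Σ (ℕ → Carrier) λ e → ∀ x → Σ ℕ λ n → e n ≈ x

record DynSys (a ℓ : Level) : Set (Level.suc (a Level.⊔ ℓ)) where
  field
    alg    : BooleanAlgebra a ℓ
    act    : BooleanAlgebra.Carrier alg → BooleanAlgebra.Carrier alg
    isAuto : IsAutomorphism alg act

open DynSys public

Incompressible : {a ℓ : Level} → DynSys a ℓ → Set (a Level.⊔ ℓ)
Incompressible S =
  ¬ (Σ Carrier λ x → ¬ (x ≈ ⊥) × ¬ (x ≈ ⊤) × _≤ᴮ_ (alg S) (act S x) x)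
  where open BooleanAlgebra (alg S) hiding (¬_)

CountableSys : {a ℓ : Level} → DynSys a ℓ → Set (a Level.⊔ ℓ)
CountableSys S = Countable (alg S)

IsSysEmbedding : {a ℓ b ℓ' : Level} (S : DynSys a ℓ) (𝔹 : BooleanAlgebra b ℓ')
                 (β : BooleanAlgebra.Carrier 𝔹 → BooleanAlgebra.Carrier 𝔹)
                 (f : BooleanAlgebra.Carrier (alg S) → BooleanAlgebra.Carrier 𝔹) → Set _
IsSysEmbedding S 𝔹 β f =
  IsBAEmbedding (alg S) 𝔹 f × (∀ x → f (act S x) B.≈ β (f x))
  where module B = BooleanAlgebra 𝔹

-- Let X be a union of intervals whose lengths and mutual distances grow, 𝔹 the σ-closed
-- subalgebra of P(ω)/Fin generated by X, and 𝔸 ⊆ 𝔹 the one generated by the sets of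
-- left and right endpoints of the intervals.  Every such algebra is incompressible, as
-- σ A ⊆* A forces A to be finite or cofinite.  The value of a term at n only depends on
-- the generators near n, and far out every window of the endpoints contains at most one
-- point; so adding to the left endpoints one spurious point in the middle of each interval
-- yields generators realising the same windows, hence satisfying the same relations
-- modulo Fin, and this defines η.  An extension η̄ would send X to a set that is entered
-- at the spurious point although it is never left after the genuine left endpoint before it.

module Submission where

open import Defs
open import Level using (0ℓ)
open import Data.Nat using (ℕ; zero; suc; _≡ᵇ_; _≤_; _<_; _+_; _*_; _∸_; _⊔_; z≤n; s≤s; _≤?_; _<?_; _≟_)
open import Data.Nat.Properties
open import Data.Bool using (Bool; true; false; not) renaming (_∧_ to _∧ᵇ_; _∨_ to _∨ᵇ_)
import Data.Bool.Properties as Boolₚ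
open import Data.Product using (Σ; _×_; _,_; proj₁; proj₂; ∃-syntax)
open import Data.Sum using (_⊎_; inj₁; inj₂)
open import Data.Empty using (⊥-elim)
open import Data.Unit using (⊤; tt)
open import Data.Nat.DivMod using (_%_; m*n%n≡0; [m+kn]%n≡m%n; m<n⇒m%n≡m)
open import Relation.Nullary using (¬_; Dec; yes; no; does)
open import Relation.Nullary.Decidable using (dec-true; dec-false; does-⇔; _×-dec_; ¬?)
open import Relation.Binary.Definitions using (tri<; tri≈; tri>)
open import Relation.Binary.PropositionalEquality using (_≡_; _≢_; refl; sym; trans; cong; cong₂; subst; subst₂; module ≡-Reasoning)
open import Function.Base using (_∘_)
open import Function.Bundles using (mk⇔; Equivalence)
open import Algebra.Lattice.Bundles using (BooleanAlgebra)

true≢false : ¬ (true ≡ false)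
true≢false ()

-- Cutting ℕ into blocks

module Blocks (L : ℕ → ℕ) (L-pos : ∀ k → 1 ≤ L k) where

  start : ℕ → ℕ
  start zero    = zero
  start (suc k) = start k + L k

  advance : (k o : ℕ) → Dec (suc o < L k) → ℕ × ℕ
  advance k o (yes _) = k , suc o
  advance k o (no _)  = suc k , zero

  locate : ℕ → ℕ × ℕ
  locate zero    = zero , zero
  locate (suc p) = let k , o = locate p in advance k o (suc o <? L k)

  block offset : ℕ → ℕ
  block  p = proj₁ (locate p)
  offset p = proj₂ (locate p)

  locate-start : ∀ k o → o < L k → locate (start k + o) ≡ (k , o)
  locate-start zero    zero    _   = refl
  locate-start (suc k) zero    _   with m≤n⇒∃[o]m+o≡n (L-pos k)
  ... | o , 1+o≡L = begin
    locate (start k + L k + 0)     ≡⟨ cong locate (trans (+-identityʳ _) (cong (start k +_) (sym 1+o≡L))) ⟩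
    locate (start k + suc o)       ≡⟨ cong locate (+-suc (start k) o) ⟩
    locate (suc (start k + o))     ≡⟨ locate-last ⟩
    (suc k , zero)                 ∎
    where
    open ≡-Reasoning
    locate-last : locate (suc (start k + o)) ≡ (suc k , zero)
    locate-last rewrite locate-start k o (subst (o <_) 1+o≡L ≤-refl) with suc o <? L k
    ... | yes o<L = ⊥-elim (<-irrefl 1+o≡L o<L)
    ... | no  _   = refl
  locate-start k (suc o) o<L rewrite +-suc (start k) o | locate-start k o (<⇒≤ o<L)
    with suc o <? L k
  ... | yes _   = refl
  ... | no  o≮L = ⊥-elim (o≮L o<L)

  locate-sound : ∀ p → start (block p) + offset p ≡ p × offset p < L (block p)
  locate-sound zero = refl , L-pos zero
  locate-sound (suc p) with locate p | locate-sound p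
  ... | k , o | p≡ , o<L with suc o <? L k
  ... | yes 1+o<L = trans (+-suc (start k) o) (cong suc p≡) , 1+o<L
  ... | no  1+o≮L = end-of-block , L-pos (suc k)
    where
    open ≡-Reasoning
    1+o≡L : suc o ≡ L k
    1+o≡L = ≤-antisym o<L (≮⇒≥ 1+o≮L)
    end-of-block : start k + L k + 0 ≡ suc p
    end-of-block = begin
      start k + L k + 0   ≡⟨ +-identityʳ _ ⟩
      start k + L k       ≡⟨ cong (start k +_) (sym 1+o≡L) ⟩
      start k + suc o     ≡⟨ +-suc (start k) o ⟩
      suc (start k + o)   ≡⟨ cong suc p≡ ⟩
      suc p               ∎

  ≤-start : ∀ k → k ≤ start k
  ≤-start zero    = z≤n
  ≤-start (suc k) = subst (_≤ start (suc k)) (+-comm k 1) (+-mono-≤ (≤-start k) (L-pos k))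

  start-mono : ∀ {k k'} → k ≤ k' → start k ≤ start k'
  start-mono {k} k≤k' with m≤n⇒∃[o]m+o≡n k≤k'
  ... | d , refl = start-≤ d
    where
    start-≤ : ∀ d → start k ≤ start (k + d)
    start-≤ zero    = ≤-reflexive (cong start (sym (+-identityʳ k)))
    start-≤ (suc d) rewrite +-suc k d = ≤-trans (start-≤ d) (m≤m+n _ _)

  block-≥ : ∀ {K p} → start K ≤ p → K ≤ block p
  block-≥ {K} {p} K≤p with K ≤? block p
  ... | yes K≤k = K≤k
  ... | no  K≰k = ⊥-elim (<-irrefl refl (begin-strict
    p                               ≡⟨ sym (proj₁ (locate-sound p)) ⟩
    start (block p) + offset p      <⟨ +-monoʳ-< (start (block p)) (proj₂ (locate-sound p)) ⟩
    start (suc (block p))           ≤⟨ start-mono (≰⇒> K≰k) ⟩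
    start K                         ≤⟨ K≤p ⟩
    p                               ∎))
    where open ≤-Reasoning hiding (start)

-- With blocks of length k + 1, locate p = (a + b , b) is the diagonal enumeration of ℕ × ℕ.
module Pairing = Blocks suc (λ _ → s≤s z≤n)

unpair : ℕ → ℕ × ℕ
unpair p = let k , o = Pairing.locate p in k ∸ o , o

unpair-surjective : ∀ a b → ∃[ p ] unpair p ≡ (a , b)
unpair-surjective a b = Pairing.start (a + b) + b , (begin
  unpair (Pairing.start (a + b) + b)   ≡⟨ cong (λ (k , o) → k ∸ o , o) (Pairing.locate-start (a + b) b (s≤s (m≤n+m b a))) ⟩
  (a + b ∸ b , b)                      ≡⟨ cong (_, b) (m+n∸n≡m a b) ⟩
  (a , b)                              ∎)
  where open ≡-Reasoning

-- Term algebras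

data Term (V : Set) : Set where
  var           : V → Term V
  top bot       : Term V
  _∨ₜ_ _∧ₜ_     : Term V → Term V → Term V
  ¬ₜ_           : Term V → Term V
  shift unshift : Term V → Term V

infixr 5 _∨ₜ_
infixr 6 _∧ₜ_
infix  7 ¬ₜ_

σ⁻¹ : Subset → Subset
σ⁻¹ A n = A (suc n)

⟦_⟧ : {V : Set} → Term V → (V → Subset) → Subset
⟦ var v     ⟧ ρ = ρ v
⟦ top       ⟧ ρ = ω
⟦ bot       ⟧ ρ = ∅
⟦ a ∨ₜ b    ⟧ ρ = ⟦ a ⟧ ρ ∪ ⟦ b ⟧ ρ
⟦ a ∧ₜ b    ⟧ ρ = ⟦ a ⟧ ρ ∩ ⟦ b ⟧ ρ
⟦ ¬ₜ a      ⟧ ρ = ∁ (⟦ a ⟧ ρ)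
⟦ shift a   ⟧ ρ = σ (⟦ a ⟧ ρ)
⟦ unshift a ⟧ ρ = σ⁻¹ (⟦ a ⟧ ρ)

module Enumeration {V : Set} (e : ℕ → V) (e-onto : ∀ v → ∃[ n ] e n ≡ v) where

  decode     : ℕ → ℕ → Term V
  decodeNode : ℕ → ℕ × ℕ → Term V

  decode zero    _ = bot
  decode (suc f) n = decodeNode f (unpair n)

  decodeNode f (0 , r) = var (e r)
  decodeNode f (1 , _) = top
  decodeNode f (2 , _) = bot
  decodeNode f (3 , r) = decode f (proj₁ (unpair r)) ∨ₜ decode f (proj₂ (unpair r))
  decodeNode f (4 , r) = decode f (proj₁ (unpair r)) ∧ₜ decode f (proj₂ (unpair r))
  decodeNode f (5 , r) = ¬ₜ decode f r
  decodeNode f (6 , r) = shift (decode f r)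
  decodeNode f (suc (suc (suc (suc (suc (suc (suc _)))))) , r) = unshift (decode f r)

  HasCode : Term V → Set
  HasCode t = ∃[ n ] ∃[ h ] ∀ f → h ≤ f → decode f n ≡ t

  leaf : ∀ tag r {t} → (∀ f → decodeNode f (tag , r) ≡ t) → HasCode t
  leaf tag r node with unpair-surjective tag r
  ... | n , n↦ = n , 1 , λ { (suc f) _ → trans (cong (decodeNode f) n↦) (node f) }

  unary : ∀ tag (c : Term V → Term V) → (∀ f r → decodeNode f (tag , r) ≡ c (decode f r)) →
          ∀ {a} → HasCode a → HasCode (c a)
  unary tag c node (n , h , ok) with unpair-surjective tag n
  ... | m , m↦ = m , suc h , λ { (suc f) (s≤s h≤f) →
    trans (cong (decodeNode f) m↦) (trans (node f n) (cong c (ok f h≤f))) }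

  binary : ∀ tag (c : Term V → Term V → Term V) →
           (∀ f r → decodeNode f (tag , r) ≡ c (decode f (proj₁ (unpair r))) (decode f (proj₂ (unpair r)))) →
           ∀ {a b} → HasCode a → HasCode b → HasCode (c a b)
  binary tag c node (n₁ , h₁ , ok₁) (n₂ , h₂ , ok₂) with unpair-surjective n₁ n₂
  ... | m , m↦ with unpair-surjective tag m
  ... | n , n↦ = n , suc (h₁ ⊔ h₂) , λ { (suc f) (s≤s h≤f) →
    trans (cong (decodeNode f) n↦) (trans (node f m)
      (cong₂ c (trans (cong (λ q → decode f (proj₁ q)) m↦) (ok₁ f (≤-trans (m≤m⊔n h₁ h₂) h≤f)))
               (trans (cong (λ q → decode f (proj₂ q)) m↦) (ok₂ f (≤-trans (m≤n⊔m h₁ h₂) h≤f))))) }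

  encode : ∀ t → HasCode t
  encode (var v) with e-onto v
  ... | r , r↦v  = leaf 0 r (λ _ → cong var r↦v)
  encode top       = leaf 1 0 (λ _ → refl)
  encode bot       = leaf 2 0 (λ _ → refl)
  encode (a ∨ₜ b)  = binary 3 _∨ₜ_ (λ _ _ → refl) (encode a) (encode b)
  encode (a ∧ₜ b)  = binary 4 _∧ₜ_ (λ _ _ → refl) (encode a) (encode b)
  encode (¬ₜ a)    = unary 5 ¬ₜ_ (λ _ _ → refl) (encode a)
  encode (shift a) = unary 6 shift (λ _ _ → refl) (encode a)
  encode (unshift a) = unary 7 unshift (λ _ _ → refl) (encode a)

  enumerate : ℕ → Term V
  enumerate p = let f , n = unpair p in decode f n

  enumerate-onto : ∀ t → ∃[ p ] enumerate p ≡ t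
  enumerate-onto t with encode t
  ... | n , h , ok with unpair-surjective h n
  ... | p , p↦ = p , trans (cong (λ (f , n) → decode f n) p↦) (ok h ≤-refl)

σ-decreasing⇒finite : ∀ A → _≤ᴮ_ PωFin (σ A) A → ¬ (A =* ω) → A =* ∅
σ-decreasing⇒finite A (N , σA≤A) A≉ω = N , absent
  where
  persists : ∀ m → N ≤ m → A m ≡ true → ∀ t → A (t + m) ≡ true
  persists m N≤m Am zero    = Am
  persists m N≤m Am (suc t) with σA≤A (suc (t + m)) (≤-trans N≤m (≤-trans (m≤n+m m t) (n≤1+n _)))
  ... | step rewrite persists m N≤m Am t = step

  absent : ∀ n → N ≤ n → A n ≡ false
  absent n N≤n with A n in An
  ... | false = refl
  ... | true  = ⊥-elim (A≉ω (n , λ p n≤p →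
    subst (λ q → A q ≡ true) (m∸n+n≡m n≤p) (persists n N≤n An (p ∸ n))))

entries exits : Subset → Subset
entries Y = Y ∩ ∁ (σ Y)
exits   Y = σ Y ∩ ∁ Y

stays-inside : ∀ Y p d → Y p ≡ true → (∀ j → j < d → exits Y (p + suc j) ≡ false) → Y (p + d) ≡ true
stays-inside Y p zero    Yp _       = subst (λ q → Y q ≡ true) (sym (+-identityʳ p)) Yp
stays-inside Y p (suc d) Yp no-exit =
  subst (λ q → Y q ≡ true) (sym (+-suc p d)) (Boolₚ.not-injective (begin
    not (Y (suc q))       ≡⟨ cong (_∧ᵇ not (Y (suc q))) (sym Yq) ⟩
    exits Y (suc q)       ≡⟨ cong (exits Y) (sym (+-suc p d)) ⟩
    exits Y (p + suc d)   ≡⟨ no-exit d ≤-refl ⟩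
    false                 ∎))
  where
  open ≡-Reasoning
  q = p + d
  Yq : Y q ≡ true
  Yq = stays-inside Y p d Yp (λ j j<d → no-exit j (m≤n⇒m≤1+n j<d))

-- The σ-closed subalgebra of P(ω)/Fin generated by the sets ρ v, with terms as elements.
module Generated {V : Set} (ρ : V → Subset) where
  private module P = BooleanAlgebra PωFin

  _≈_ : Term V → Term V → Set
  a ≈ b = ⟦ a ⟧ ρ =* ⟦ b ⟧ ρ

  algebra : BooleanAlgebra 0ℓ 0ℓ
  algebra = record
    { Carrier = Term V
    ; _≈_ = _≈_
    ; _∨_ = _∨ₜ_
    ; _∧_ = _∧ₜ_
    ; ¬_ = ¬ₜ_
    ; ⊤ = top
    ; ⊥ = bot
    ; isBooleanAlgebra = record
      { isDistributiveLattice = record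
        { isLattice = record
          { isEquivalence = record { refl = P.refl ; sym = P.sym ; trans = P.trans }
          ; ∨-comm = λ a b → P.∨-comm (⟦ a ⟧ ρ) (⟦ b ⟧ ρ)
          ; ∨-assoc = λ a b c → P.∨-assoc (⟦ a ⟧ ρ) (⟦ b ⟧ ρ) (⟦ c ⟧ ρ)
          ; ∨-cong = P.∨-cong
          ; ∧-comm = λ a b → P.∧-comm (⟦ a ⟧ ρ) (⟦ b ⟧ ρ)
          ; ∧-assoc = λ a b c → P.∧-assoc (⟦ a ⟧ ρ) (⟦ b ⟧ ρ) (⟦ c ⟧ ρ)
          ; ∧-cong = P.∧-cong
          ; absorptive = (λ a b → proj₁ P.absorptive (⟦ a ⟧ ρ) (⟦ b ⟧ ρ))
                       , (λ a b → proj₂ P.absorptive (⟦ a ⟧ ρ) (⟦ b ⟧ ρ))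
          }
        ; ∨-distrib-∧ = (λ a b c → proj₁ P.∨-distrib-∧ (⟦ a ⟧ ρ) (⟦ b ⟧ ρ) (⟦ c ⟧ ρ))
                      , (λ a b c → proj₂ P.∨-distrib-∧ (⟦ a ⟧ ρ) (⟦ b ⟧ ρ) (⟦ c ⟧ ρ))
        ; ∧-distrib-∨ = (λ a b c → proj₁ P.∧-distrib-∨ (⟦ a ⟧ ρ) (⟦ b ⟧ ρ) (⟦ c ⟧ ρ))
                      , (λ a b c → proj₂ P.∧-distrib-∨ (⟦ a ⟧ ρ) (⟦ b ⟧ ρ) (⟦ c ⟧ ρ))
        }
      ; ∨-complement = (λ a → proj₁ P.∨-complement (⟦ a ⟧ ρ))
                     , (λ a → proj₂ P.∨-complement (⟦ a ⟧ ρ))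
      ; ∧-complement = (λ a → proj₁ P.∧-complement (⟦ a ⟧ ρ))
                     , (λ a → proj₂ P.∧-complement (⟦ a ⟧ ρ))
      ; ¬-cong = P.¬-cong
      }
    }

  shift-isAutomorphism : IsAutomorphism algebra shift
  shift-isAutomorphism = record
    { isEmbedding = record
      { isHom = record
        { cong-≈ = λ { (N , p) → suc N , λ { zero () ; (suc n) (s≤s N≤n) → p n N≤n } }
        ; hom-∨  = λ _ _ → 0 , λ { zero _ → refl ; (suc n) _ → refl }
        ; hom-∧  = λ _ _ → 0 , λ { zero _ → refl ; (suc n) _ → refl }
        ; hom-¬  = λ _ → 1 , λ { (suc n) _ → refl }
        ; hom-⊤  = 1 , λ { (suc n) _ → refl }
        ; hom-⊥  = 0 , λ { zero _ → refl ; (suc n) _ → refl }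
        }
      ; injective = λ { (N , p) → N , λ n N≤n → p (suc n) (m≤n⇒m≤1+n N≤n) }
      }
    ; surjective = λ a → unshift a , (1 , λ { (suc n) _ → refl })
    }

  system : DynSys 0ℓ 0ℓ
  system = record { alg = algebra ; act = shift ; isAuto = shift-isAutomorphism }

  incompressible : Incompressible system
  incompressible (a , a≉⊥ , a≉⊤ , shift-a≤a) = a≉⊥ (σ-decreasing⇒finite (⟦ a ⟧ ρ) shift-a≤a a≉⊤)

  countable : (e : ℕ → V) → (∀ v → ∃[ n ] e n ≡ v) → CountableSys system
  countable e e-onto = enumerate , λ t → let p , p↦t = enumerate-onto t in
    p , subst (λ s → ⟦ s ⟧ ρ =* ⟦ t ⟧ ρ) (sym p↦t) P.refl
    where open Enumeration e e-onto

≗⇒=* : {A B : Subset} → (∀ n → A n ≡ B n) → A =* B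
≗⇒=* A≗B = 0 , λ n _ → A≗B n

infixl 9 _[_]

_[_] : {V W : Set} → Term V → (V → Term W) → Term W
var v     [ τ ] = τ v
top       [ τ ] = top
bot       [ τ ] = bot
(a ∨ₜ b)  [ τ ] = a [ τ ] ∨ₜ b [ τ ]
(a ∧ₜ b)  [ τ ] = a [ τ ] ∧ₜ b [ τ ]
(¬ₜ a)    [ τ ] = ¬ₜ (a [ τ ])
shift a   [ τ ] = shift (a [ τ ])
unshift a [ τ ] = unshift (a [ τ ])

⟦⟧-[] : ∀ {V W} {ρ : W → Subset} {ρ₀ : V → Subset} (τ : V → Term W) →
        (∀ v n → ⟦ τ v ⟧ ρ n ≡ ρ₀ v n) → ∀ t n → ⟦ t [ τ ] ⟧ ρ n ≡ ⟦ t ⟧ ρ₀ n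
⟦⟧-[] τ τ-sound (var v)     n       = τ-sound v n
⟦⟧-[] τ τ-sound top         n       = refl
⟦⟧-[] τ τ-sound bot         n       = refl
⟦⟧-[] τ τ-sound (a ∨ₜ b)    n       = cong₂ _∨ᵇ_ (⟦⟧-[] τ τ-sound a n) (⟦⟧-[] τ τ-sound b n)
⟦⟧-[] τ τ-sound (a ∧ₜ b)    n       = cong₂ _∧ᵇ_ (⟦⟧-[] τ τ-sound a n) (⟦⟧-[] τ τ-sound b n)
⟦⟧-[] τ τ-sound (¬ₜ a)      n       = cong not (⟦⟧-[] τ τ-sound a n)
⟦⟧-[] τ τ-sound (shift a)   zero    = refl
⟦⟧-[] τ τ-sound (shift a)   (suc n) = ⟦⟧-[] τ τ-sound a n
⟦⟧-[] τ τ-sound (unshift a) n       = ⟦⟧-[] τ τ-sound a (suc n)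

=*-respects-≗ : {A A' B B' : Subset} → (∀ n → A n ≡ A' n) → (∀ n → B n ≡ B' n) → A =* B → A' =* B'
=*-respects-≗ A≗A' B≗B' (N , A≡B) = N , λ n N≤n → trans (sym (A≗A' n)) (trans (A≡B n N≤n) (B≗B' n))

substitution-embedding : ∀ {V W} {ρ : W → Subset} {ρ₀ : V → Subset} (τ : V → Term W) →
                         (∀ v n → ⟦ τ v ⟧ ρ n ≡ ρ₀ v n) →
                         IsSysEmbedding (Generated.system ρ₀) (Generated.algebra ρ) shift (_[ τ ])
substitution-embedding τ τ-sound = record
  { isHom = record
    { cong-≈ = λ {a} {b} → =*-respects-≗ (sym ∘ sound a) (sym ∘ sound b)
    ; hom-∨  = λ _ _ → ≗⇒=* λ _ → refl
    ; hom-∧  = λ _ _ → ≗⇒=* λ _ → refl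
    ; hom-¬  = λ _ → ≗⇒=* λ _ → refl
    ; hom-⊤  = ≗⇒=* λ _ → refl
    ; hom-⊥  = ≗⇒=* λ _ → refl
    }
  ; injective = λ {a} {b} → =*-respects-≗ (sound a) (sound b)
  } , λ _ → ≗⇒=* λ _ → refl
  where sound = ⟦⟧-[] τ τ-sound

-- Locality of terms

module _ {V : Set} where

  depth : Term V → ℕ
  depth (var _)     = 0
  depth top         = 0
  depth bot         = 0
  depth (a ∨ₜ b)    = depth a ⊔ depth b
  depth (a ∧ₜ b)    = depth a ⊔ depth b
  depth (¬ₜ a)      = depth a
  depth (shift a)   = suc (depth a)
  depth (unshift a) = suc (depth a)

  Agree : (ρ ρ' : V → Subset) (w n m : ℕ) → Set
  Agree ρ ρ' w n m = ∀ v i → i ≤ w → ρ v (n + i) ≡ ρ' v (m + i)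

  Agree-within : ∀ {ρ ρ' w w' n m} d → d + w' ≤ w → Agree ρ ρ' w n m → Agree ρ ρ' w' (d + n) (d + m)
  Agree-within {ρ} {ρ'} {n = n} {m} d d+w'≤w agree v i i≤w' =
    trans (cong (ρ v) (reassoc n)) (trans (agree v (d + i) (≤-trans (+-monoʳ-≤ d i≤w') d+w'≤w))
                                          (cong (ρ' v) (sym (reassoc m))))
    where
    reassoc : ∀ x → d + x + i ≡ x + (d + i)
    reassoc x = trans (cong (_+ i) (+-comm d x)) (+-assoc x d i)

  ⟦⟧-local : ∀ {ρ ρ'} t r n m → depth t ≤ r → Agree ρ ρ' (r + r) n m → ⟦ t ⟧ ρ (n + r) ≡ ⟦ t ⟧ ρ' (m + r)
  ⟦⟧-local (var v) r n m _ agree = agree v r (m≤m+n r r)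
  ⟦⟧-local top     r n m _ _     = refl
  ⟦⟧-local bot     r n m _ _     = refl
  ⟦⟧-local (a ∨ₜ b) r n m d≤r agree =
    cong₂ _∨ᵇ_ (⟦⟧-local a r n m (m⊔n≤o⇒m≤o _ _ d≤r) agree) (⟦⟧-local b r n m (m⊔n≤o⇒n≤o _ _ d≤r) agree)
  ⟦⟧-local (a ∧ₜ b) r n m d≤r agree =
    cong₂ _∧ᵇ_ (⟦⟧-local a r n m (m⊔n≤o⇒m≤o _ _ d≤r) agree) (⟦⟧-local b r n m (m⊔n≤o⇒n≤o _ _ d≤r) agree)
  ⟦⟧-local (¬ₜ a) r n m d≤r agree = cong not (⟦⟧-local a r n m d≤r agree)
  ⟦⟧-local {ρ} {ρ'} (shift a) (suc r) n m (s≤s d≤r) agree rewrite +-suc n r | +-suc m r =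
    ⟦⟧-local a r n m d≤r (Agree-within {ρ} {ρ'} {n = n} {m} 0 (+-mono-≤ (n≤1+n r) (n≤1+n r)) agree)
  ⟦⟧-local {ρ} {ρ'} (unshift a) (suc r) n m (s≤s d≤r) agree rewrite +-suc n r | +-suc m r =
    ⟦⟧-local a r (2 + n) (2 + m) d≤r (Agree-within {ρ} {ρ'} {n = n} {m} 2 (≤-reflexive (sym (cong suc (+-suc r r)))) agree)

  Similar : (ρ ρ' : V → Subset) → Set
  Similar ρ ρ' = ∀ w N → ∃[ M ] ∀ n → M ≤ n → ∃[ m ] N ≤ m × Agree ρ ρ' w n m

  transfer : ∀ {ρ ρ'} → Similar ρ ρ' → ∀ a b → ⟦ a ⟧ ρ' =* ⟦ b ⟧ ρ' → ⟦ a ⟧ ρ =* ⟦ b ⟧ ρ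
  transfer {ρ} {ρ'} similar a b (N , a≡b) = M + r , agree-at
    where
    r = depth a ⊔ depth b
    M = proj₁ (similar (r + r) N)
    agree-at : ∀ p → M + r ≤ p → ⟦ a ⟧ ρ p ≡ ⟦ b ⟧ ρ p
    agree-at p M+r≤p with proj₂ (similar (r + r) N) (p ∸ r) (m+n≤o⇒m≤o∸n M M+r≤p)
    ... | m , N≤m , agree = subst (λ q → ⟦ a ⟧ ρ q ≡ ⟦ b ⟧ ρ q) (m∸n+n≡m (m+n≤o⇒n≤o M M+r≤p))
      (trans (⟦⟧-local a r (p ∸ r) m (m≤m⊔n _ _) agree)
      (trans (a≡b (m + r) (≤-trans N≤m (m≤m+n m r)))
             (sym (⟦⟧-local b r (p ∸ r) m (m≤n⊔m _ _) agree))))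

  evaluation-embedding : ∀ {ρ ρ'} → Similar ρ' ρ → Similar ρ ρ' →
                         IsSysEmbedding (Generated.system ρ) PωFin σ (λ t → ⟦ t ⟧ ρ')
  evaluation-embedding ρ'∼ρ ρ∼ρ' = record
    { isHom = record
      { cong-≈ = λ {a} {b} → transfer ρ'∼ρ a b
      ; hom-∨  = λ _ _ → ≗⇒=* λ _ → refl
      ; hom-∧  = λ _ _ → ≗⇒=* λ _ → refl
      ; hom-¬  = λ _ → ≗⇒=* λ _ → refl
      ; hom-⊤  = ≗⇒=* λ _ → refl
      ; hom-⊥  = ≗⇒=* λ _ → refl
      }
    ; injective = λ {a} {b} → transfer ρ∼ρ' a b
    } , λ _ → ≗⇒=* λ _ → refl

-- Sparse valuations

Exhaustible : Set → Set
Exhaustible A = ∀ (f : A → Bool) → (∃[ a ] f a ≡ true) ⊎ (∀ a → f a ≡ false)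

module _ {V : Set} where

  Blank : (ρ : V → Subset) (w m : ℕ) → Set
  Blank ρ w m = ∀ v i → i ≤ w → ρ v (m + i) ≡ false

  Recurrent : (ρ : V → Subset) → Set
  Recurrent ρ = ∀ v N → ∃[ p ] N ≤ p × ρ v p ≡ true

  record Sparse (ρ : V → Subset) : Set where
    field
      single-label : ∀ {v v' p} → ρ v p ≡ true → ρ v' p ≡ true → v ≡ v'
      isolated     : ∀ w → ∃[ N ] ∀ {v v' p j} → N ≤ p → ρ v p ≡ true → 0 < j → j ≤ w → ρ v' (p + j) ≡ false

  Sparse-mono : ∀ {ρ ρ'} → (∀ v p → ρ v p ≡ true → ρ' v p ≡ true) → Sparse ρ' → Sparse ρ
  Sparse-mono {ρ} {ρ'} ρ⊆ρ' sparse = record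
    { single-label = λ {v} {v'} {p} ρv ρv' → single-label (ρ⊆ρ' v p ρv) (ρ⊆ρ' v' p ρv')
    ; isolated     = λ w → let N , gap = isolated w in N , λ {v} {v'} {p} {j} N≤p ρv 0<j j≤w →
        unmarked v' (p + j) (gap N≤p (ρ⊆ρ' v p ρv) 0<j j≤w)
    }
    where
    open Sparse sparse
    unmarked : ∀ v q → ρ' v q ≡ false → ρ v q ≡ false
    unmarked v q ρ'v with ρ v q in ρv
    ... | false = refl
    ... | true  = trans (sym (ρ⊆ρ' v q ρv)) ρ'v

  same-mark : ∀ {ρ} → Sparse ρ → ∀ w → ∃[ N ] ∀ {v v' n i j} → N ≤ n → i ≤ w → j ≤ w →
              ρ v (n + i) ≡ true → ρ v' (n + j) ≡ true → v ≡ v' × i ≡ j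
  same-mark {ρ} sparse w = N , same
    where
    open Sparse sparse
    N = proj₁ (isolated w)

    apart : ∀ {v v' n i j} → N ≤ n → i < j → j ≤ w → ρ v (n + i) ≡ true → ρ v' (n + j) ≡ false
    apart {v} {v'} {n} {i} {j} N≤n i<j j≤w ρv with m≤n⇒∃[o]m+o≡n i<j
    ... | d , i+1+d≡j = subst (λ q → ρ v' q ≡ false) n+i+[1+d]≡n+j
      (proj₂ (isolated w) (≤-trans N≤n (m≤m+n n i)) ρv (s≤s z≤n)
                          (≤-trans (m≤n+m (suc d) i) (subst (_≤ w) (sym i+[1+d]≡j) j≤w)))
      where
      i+[1+d]≡j : i + suc d ≡ j
      i+[1+d]≡j = trans (+-suc i d) i+1+d≡j
      n+i+[1+d]≡n+j : n + i + suc d ≡ n + j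
      n+i+[1+d]≡n+j = trans (+-assoc n i (suc d)) (cong (n +_) i+[1+d]≡j)

    same : ∀ {v v' n i j} → N ≤ n → i ≤ w → j ≤ w →
           ρ v (n + i) ≡ true → ρ v' (n + j) ≡ true → v ≡ v' × i ≡ j
    same {n = n} {i} {j} N≤n i≤w j≤w ρv ρv' with <-cmp i j
    ... | tri< i<j _ _ = ⊥-elim (true≢false (trans (sym ρv') (apart N≤n i<j j≤w ρv)))
    ... | tri> _ _ j<i = ⊥-elim (true≢false (trans (sym ρv) (apart N≤n j<i i≤w ρv')))
    ... | tri≈ _ refl _ = single-label ρv ρv' , refl

  scan : Exhaustible V → ∀ ρ n w → (∃[ v ] ∃[ i ] i ≤ w × ρ v (n + i) ≡ true) ⊎ Blank ρ w n
  scan exhaust ρ n zero with exhaust (λ v → ρ v (n + 0))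
  ... | inj₁ (v , ρv) = inj₁ (v , 0 , z≤n , ρv)
  ... | inj₂ blank    = inj₂ λ { v .0 z≤n → blank v }
  scan exhaust ρ n (suc w) with scan exhaust ρ n w
  ... | inj₁ (v , i , i≤w , ρv) = inj₁ (v , i , m≤n⇒m≤1+n i≤w , ρv)
  ... | inj₂ blank with exhaust (λ v → ρ v (n + suc w))
  ...   | inj₁ (v , ρv) = inj₁ (v , suc w , ≤-refl , ρv)
  ...   | inj₂ blank′   = inj₂ λ v i i≤1+w → case-split v i (m≤n⇒m<n∨m≡n i≤1+w)
    where
    case-split : ∀ v i → i < suc w ⊎ i ≡ suc w → ρ v (n + i) ≡ false
    case-split v i (inj₁ i<1+w) = blank v i (≤-pred i<1+w)
    case-split v i (inj₂ refl)  = blank′ v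

  blank-windows : ∀ {ρ} → Exhaustible V → Sparse ρ → Recurrent ρ → ∀ w N → ∃[ m ] N ≤ m × Blank ρ w m
  blank-windows {ρ} exhaust sparse recurrent w N with exhaust (λ _ → true)
  ... | inj₂ empty  = N , ≤-refl , λ v → ⊥-elim (true≢false (empty v))
  ... | inj₁ (v , _) with Sparse.isolated sparse (suc w)
  ...   | M , gap with recurrent v (N + M)
  ...     | p , N+M≤p , ρv = suc p , ≤-trans (m+n≤o⇒m≤o N N+M≤p) (n≤1+n p) , λ u i i≤w →
    subst (λ q → ρ u q ≡ false) (+-suc p i) (gap (m+n≤o⇒n≤o N N+M≤p) ρv (s≤s z≤n) (s≤s i≤w))

  sparse-similar : ∀ {ρ ρ'} → Exhaustible V → Sparse ρ → Sparse ρ' → Recurrent ρ' → Similar ρ ρ'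
  sparse-similar {ρ} {ρ'} exhaust sρ sρ' recurrent w N = M , match
    where
    M  = proj₁ (same-mark sρ w)
    M' = proj₁ (same-mark sρ' w)

    match : ∀ n → M ≤ n → ∃[ m ] N ≤ m × Agree ρ ρ' w n m
    match n M≤n with scan exhaust ρ n w
    ... | inj₂ blank with blank-windows exhaust sρ' recurrent w N
    ...   | m , N≤m , blank' = m , N≤m , λ v i i≤w → trans (blank v i i≤w) (sym (blank' v i i≤w))
    match n M≤n | inj₁ (v , i , i≤w , ρv) with recurrent v (N + M' + i)
    ...   | p , N+M'+i≤p , ρ'v = p ∸ i , m+n≤o⇒m≤o N N+M'≤m , agree
      where
      N+M'≤m : N + M' ≤ p ∸ i
      N+M'≤m = m+n≤o⇒m≤o∸n (N + M') N+M'+i≤p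
      ρ'v′ : ρ' v (p ∸ i + i) ≡ true
      ρ'v′ = subst (λ q → ρ' v q ≡ true) (sym (m∸n+n≡m (m+n≤o⇒n≤o (N + M') N+M'+i≤p))) ρ'v
      agree : Agree ρ ρ' w n (p ∸ i)
      agree u j j≤w = Boolₚ.⇔→≡ {z = true} (mk⇔
        (λ ρu → let v≡u , i≡j = proj₂ (same-mark sρ w) M≤n i≤w j≤w ρv ρu in
                subst₂ (λ x y → ρ' x (p ∸ i + y) ≡ true) v≡u i≡j ρ'v′)
        (λ ρ'u → let v≡u , i≡j = proj₂ (same-mark sρ' w) (m+n≤o⇒n≤o N N+M'≤m) i≤w j≤w ρ'v′ ρ'u in
                 subst₂ (λ x y → ρ x (n + y) ≡ true) v≡u i≡j ρv))

module Layout = Blocks (λ k → 4 * suc k) (λ _ → s≤s z≤n)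
open Layout using (start; locate; block; offset)

mark : ℕ → Subset
mark c p = does (offset p ≟ c * suc (block p))

Inside : ℕ → ℕ → Set
Inside k o = suc k ≤ o × o < 3 * suc k

Inside? : ∀ k o → Dec (Inside k o)
Inside? k o = suc k ≤? o ×-dec o <? 3 * suc k

inside : ℕ → ℕ → Bool
inside k o = does (Inside? k o)

X : Subset
X p = inside (block p) (offset p)

enters : ∀ k o → inside k (suc o) ∧ᵇ not (inside k o) ≡ does (suc o ≟ 1 * suc k)
enters k o = does-⇔ (mk⇔ to from) (Inside? k (suc o) ×-dec ¬? (Inside? k o)) (suc o ≟ 1 * suc k)
  where
  to : Inside k (suc o) × ¬ Inside k o → suc o ≡ 1 * suc k
  to ((k<1+o , 1+o<3k) , outside) with m≤n⇒m<n∨m≡n (≤-pred k<1+o)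
  ... | inj₁ k<o  = ⊥-elim (outside (k<o , <⇒≤ 1+o<3k))
  ... | inj₂ refl = sym (*-identityˡ (suc k))
  from : suc o ≡ 1 * suc k → Inside k (suc o) × ¬ Inside k o
  from 1+o≡1+k with suc-injective (trans 1+o≡1+k (*-identityˡ (suc k)))
  ... | refl = (≤-refl , m<m+n (suc o) (s≤s z≤n)) , λ (1+o≤o , _) → n≮n o 1+o≤o

leaves : ∀ k o → inside k o ∧ᵇ not (inside k (suc o)) ≡ does (suc o ≟ 3 * suc k)
leaves k o = does-⇔ (mk⇔ to from) (Inside? k o ×-dec ¬? (Inside? k (suc o))) (suc o ≟ 3 * suc k)
  where
  to : Inside k o × ¬ Inside k (suc o) → suc o ≡ 3 * suc k
  to ((k<o , o<3k) , outside) = ≤-antisym o<3k (≮⇒≥ λ 1+o<3k → outside (m≤n⇒m≤1+n k<o , 1+o<3k))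
  from : suc o ≡ 3 * suc k → Inside k o × ¬ Inside k (suc o)
  from 1+o≡3k = (≤-pred (subst (suc k <_) (sym 1+o≡3k) (m<m+n (suc k) (s≤s z≤n))) , ≤-reflexive 1+o≡3k)
              , λ (_ , 1+o<3k) → <-irrefl 1+o≡3k 1+o<3k

X-entries : ∀ p → entries X p ≡ mark 1 p
X-entries zero = refl
X-entries (suc q) with locate q
... | k , o with suc o <? 4 * suc k
...   | yes _ = enters k o
...   | no  _ = refl

X-exits : ∀ p → exits X p ≡ mark 3 p
X-exits zero = refl
X-exits (suc q) with locate q
... | k , o with suc o <? 4 * suc k
...   | yes _      = leaves k o
...   | no  1+o≮4k = cong (_∧ᵇ not (inside (suc k) 0)) (dec-false (Inside? k o) λ (_ , o<3k) → <⇒≱ o<3k 3k≤o)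
  where
  3k≤o : 3 * suc k ≤ o
  3k≤o = m+n≤o⇒n≤o k (≤-pred (≮⇒≥ 1+o≮4k))

mark-start : ∀ c k o → o < 4 * suc k → mark c (start k + o) ≡ does (o ≟ c * suc k)
mark-start c k o o<4k rewrite Layout.locate-start k o o<4k = refl

mark-offset : ∀ c p → mark c p ≡ true → offset p ≡ c * suc (block p)
mark-offset c p marked = ≡ᵇ⇒≡ (offset p) (c * suc (block p)) (Equivalence.from Boolₚ.T-≡ marked)

mark-unique : ∀ {c c' p} → mark c p ≡ true → mark c' p ≡ true → c ≡ c'
mark-unique {c} {c'} {p} m m' = *-cancelʳ-≡ c c' (suc (block p)) (trans (sym (mark-offset c p m)) (mark-offset c' p m'))

mark-isolated : ∀ {c p j} c' → c ≤ 3 → mark c p ≡ true → 0 < j → j ≤ block p → mark c' (p + j) ≡ false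
mark-isolated {c} {p} {j} c' c≤3 marked 0<j j≤k = begin
  mark c' (p + j)                      ≡⟨ cong (mark c') p+j≡ ⟩
  mark c' (start k + (j + c * suc k))  ≡⟨ mark-start c' k _ in-block ⟩
  does (j + c * suc k ≟ c' * suc k)    ≡⟨ dec-false (j + c * suc k ≟ c' * suc k) off-grid ⟩
  false                                ∎
  where
  open ≡-Reasoning
  k = block p
  p+j≡ : p + j ≡ start k + (j + c * suc k)
  p+j≡ = begin
    p + j                       ≡⟨ cong (_+ j) (sym (proj₁ (Layout.locate-sound p))) ⟩
    start k + offset p + j      ≡⟨ cong (λ o → start k + o + j) (mark-offset c p marked) ⟩
    start k + c * suc k + j     ≡⟨ +-assoc (start k) _ j ⟩
    start k + (c * suc k + j)   ≡⟨ cong (start k +_) (+-comm _ j) ⟩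
    start k + (j + c * suc k)   ∎
  in-block : j + c * suc k < 4 * suc k
  in-block = +-mono-≤ (s≤s j≤k) (*-monoˡ-≤ (suc k) c≤3)
  off-grid : j + c * suc k ≢ c' * suc k
  off-grid eq = <⇒≢ 0<j (begin
    0                           ≡⟨ sym (m*n%n≡0 c' (suc k)) ⟩
    c' * suc k % suc k          ≡⟨ cong (_% suc k) (sym eq) ⟩
    (j + c * suc k) % suc k     ≡⟨ [m+kn]%n≡m%n j c (suc k) ⟩
    j % suc k                   ≡⟨ m<n⇒m%n≡m (s≤s j≤k) ⟩
    j                           ∎)

mark-recurrent : ∀ {c} → c < 4 → ∀ N → ∃[ p ] N ≤ p × mark c p ≡ true
mark-recurrent {c} c<4 N = start N + c * suc N , ≤-trans (Layout.≤-start N) (m≤m+n _ _)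
  , trans (mark-start c N _ (*-monoˡ-< (suc N) c<4)) (dec-true (c * suc N ≟ c * suc N) refl)

-- Block k has length 4(k+1) and X fills its offsets [k+1, 3(k+1)), so the left and right
-- endpoints sit at the marks 1 and 3; ends′ adds a spurious left endpoint at mark 2.
ends ends′ : Bool → Subset
ends true  = mark 1
ends false = mark 3
ends′ true  = mark 1 ∪ mark 2
ends′ false = mark 3

ends⊆ends′ : ∀ v p → ends v p ≡ true → ends′ v p ≡ true
ends⊆ends′ true  p m₁ = cong (_∨ᵇ mark 2 p) m₁
ends⊆ends′ false p m₃ = m₃

label : ℕ → Bool
label 3 = false
label _ = true

ends′-marked : ∀ v p → ends′ v p ≡ true → ∃[ c ] c ≤ 3 × label c ≡ v × mark c p ≡ true
ends′-marked true p m₁₂ with mark 1 p in m₁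
... | true  = 1 , s≤s z≤n , refl , m₁
... | false = 2 , s≤s (s≤s z≤n) , refl , m₁₂
ends′-marked false p m₃ = 3 , ≤-refl , refl , m₃

ends′-unmarked : ∀ v q → (∀ c → mark c q ≡ false) → ends′ v q ≡ false
ends′-unmarked true  q none rewrite none 1 | none 2 = refl
ends′-unmarked false q none = none 3

ends′-sparse : Sparse ends′
ends′-sparse = record
  { single-label = λ {v} {v'} {p} m m' →
      let c , _ , c↦v , mc = ends′-marked v p m ; c' , _ , c'↦v' , mc' = ends′-marked v' p m' in
      trans (sym c↦v) (trans (cong label (mark-unique {c} {c'} {p} mc mc')) c'↦v')
  ; isolated = λ w → start w , λ {v} {v'} {p} {j} w≤p m 0<j j≤w →
      let c , c≤3 , _ , mc = ends′-marked v p m in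
      ends′-unmarked v' (p + j) λ c' → mark-isolated {p = p} c' c≤3 mc 0<j (≤-trans j≤w (Layout.block-≥ w≤p))
  }

ends-recurrent : Recurrent ends
ends-recurrent true  = mark-recurrent (s≤s (s≤s z≤n))
ends-recurrent false = mark-recurrent ≤-refl

ends′-recurrent : Recurrent ends′
ends′-recurrent v N = let p , N≤p , m = ends-recurrent v N in p , N≤p , ends⊆ends′ v p m

Bool-exhaustible : Exhaustible Bool
Bool-exhaustible f with f true in ft | f false in ff
... | true  | _     = inj₁ (true , ft)
... | false | true  = inj₁ (false , ff)
... | false | false = inj₂ λ { true → ft ; false → ff }

ends∼ends′ : Similar ends ends′
ends∼ends′ = sparse-similar {ρ = ends} {ends′} Bool-exhaustible (Sparse-mono ends⊆ends′ ends′-sparse) ends′-sparse ends′-recurrent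

ends′∼ends : Similar ends′ ends
ends′∼ends = sparse-similar {ρ = ends′} {ends} Bool-exhaustible ends′-sparse (Sparse-mono ends⊆ends′ ends′-sparse) ends-recurrent

no-filling : ∀ Y → ¬ (entries Y =* ends′ true × exits Y =* ends′ false)
no-filling Y ((N₁ , entries≡) , (N₂ , exits≡)) = true≢false (trans (sym Y-before-spurious) Y-not-before-spurious)
  where
  open ≡-Reasoning
  k = N₁ ⊔ N₂
  p = start k + suc k

  far : ∀ {N} o → N ≤ k → N ≤ start k + o
  far o N≤k = ≤-trans N≤k (≤-trans (Layout.≤-start k) (m≤m+n _ o))

  within : ∀ o → o < 3 * suc k → o < 4 * suc k
  within o o<3k = ≤-trans o<3k (m≤n+m _ (suc k))

  2k<3k : suc k + suc k < 3 * suc k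
  2k<3k = +-monoʳ-< (suc k) (m<m+n (suc k) (s≤s z≤n))

  enters-p : entries Y p ≡ true
  enters-p = trans (entries≡ p (far (suc k) (m≤m⊔n N₁ N₂)))
    (cong (_∨ᵇ mark 2 p) (trans (mark-start 1 k (suc k) (within _ (m<m+n (suc k) (s≤s z≤n))))
                                (dec-true (suc k ≟ 1 * suc k) (sym (*-identityˡ (suc k))))))

  no-exit : ∀ j → j < k → exits Y (p + suc j) ≡ false
  no-exit j j<k = begin
    exits Y (p + suc j)                  ≡⟨ cong (exits Y) (+-assoc (start k) (suc k) (suc j)) ⟩
    exits Y (start k + (suc k + suc j))  ≡⟨ exits≡ _ (far _ (m≤n⊔m N₁ N₂)) ⟩
    mark 3 (start k + (suc k + suc j))   ≡⟨ mark-start 3 k _ (within _ o<3k) ⟩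
    does (suc k + suc j ≟ 3 * suc k)     ≡⟨ dec-false (suc k + suc j ≟ 3 * suc k) (<⇒≢ o<3k) ⟩
    false                                ∎
    where
    o<3k : suc k + suc j < 3 * suc k
    o<3k = <-trans (+-monoʳ-< (suc k) (s≤s j<k)) 2k<3k

  Y-before-spurious : Y (p + k) ≡ true
  Y-before-spurious = stays-inside Y p k (Boolₚ.∧-conicalˡ _ _ enters-p) no-exit

  e = start k + (suc k + suc k)

  enters-spurious : entries Y e ≡ true
  enters-spurious = begin
    entries Y e                                   ≡⟨ entries≡ e (far _ (m≤m⊔n N₁ N₂)) ⟩
    mark 1 e ∨ᵇ mark 2 e                          ≡⟨ cong (mark 1 e ∨ᵇ_) (mark-start 2 k _ (within _ 2k<3k)) ⟩
    mark 1 e ∨ᵇ does (suc k + suc k ≟ 2 * suc k)  ≡⟨ cong (mark 1 e ∨ᵇ_) (dec-true (suc k + suc k ≟ 2 * suc k) 2k≡2k) ⟩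
    mark 1 e ∨ᵇ true                              ≡⟨ Boolₚ.∨-zeroʳ _ ⟩
    true                                          ∎
    where
    2k≡2k : suc k + suc k ≡ 2 * suc k
    2k≡2k = cong (suc k +_) (sym (+-identityʳ (suc k)))

  Y-not-before-spurious : Y (p + k) ≡ false
  Y-not-before-spurious = Boolₚ.not-injective (begin
    not (Y (p + k))                         ≡⟨⟩
    not (σ Y (suc (p + k)))                 ≡⟨ cong (not ∘ σ Y) (sym (+-suc p k)) ⟩
    not (σ Y (p + suc k))                   ≡⟨ cong (not ∘ σ Y) (+-assoc (start k) (suc k) (suc k)) ⟩
    not (σ Y e)                             ≡⟨ Boolₚ.∧-conicalʳ _ _ enters-spurious ⟩
    true                                    ∎)

boundary : Bool → Term ⊤
boundary true  = var tt ∧ₜ ¬ₜ shift (var tt)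
boundary false = shift (var tt) ∧ₜ ¬ₜ var tt

boundary-sound : ∀ v n → ⟦ boundary v ⟧ (λ _ → X) n ≡ ends v n
boundary-sound true  = X-entries
boundary-sound false = X-exits

no-extension : ∀ η̄ → IsSysEmbedding (Generated.system (λ (_ : ⊤) → X)) PωFin σ η̄ →
               ¬ (∀ v → η̄ (boundary v) =* ends′ v)
no-extension η̄ (embedding , η̄-σ) agrees =
  no-filling Y (P.trans (P.sym entries≈) (agrees true) , P.trans (P.sym exits≈) (agrees false))
  where
  module P = BooleanAlgebra PωFin
  open IsBAHom (IsBAEmbedding.isHom embedding)
  Y = η̄ (var tt)
  entries≈ : η̄ (boundary true) =* entries Y
  entries≈ = P.trans (hom-∧ _ _) (P.∧-cong P.refl (P.trans (hom-¬ _) (P.¬-cong (η̄-σ (var tt)))))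
  exits≈ : η̄ (boundary false) =* exits Y
  exits≈ = P.trans (hom-∧ _ _) (P.∧-cong (η̄-σ (var tt)) (hom-¬ _))

theorem5p1 : Σ (DynSys 0ℓ 0ℓ) λ 𝔸 → Σ (DynSys 0ℓ 0ℓ) λ 𝔹 →
    CountableSys 𝔸 × CountableSys 𝔹 × Incompressible 𝔸 × Incompressible 𝔹 ×
    Σ (BooleanAlgebra.Carrier (alg 𝔸) → BooleanAlgebra.Carrier (alg 𝔹)) λ ι →
    Σ (BooleanAlgebra.Carrier (alg 𝔸) → Subset) λ η →
      IsSysEmbedding 𝔸 (alg 𝔹) (act 𝔹) ι × IsSysEmbedding 𝔸 PωFin σ η ×
      ¬ (Σ (BooleanAlgebra.Carrier (alg 𝔹) → Subset) λ η̄ →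
           IsSysEmbedding 𝔹 PωFin σ η̄ × (∀ x → η̄ (ι x) =* η x))
theorem5p1 =
  A.system , B.system , A.countable (λ n → n ≡ᵇ 0) Bool-onto , B.countable (λ _ → tt) (λ _ → 0 , refl) ,
  A.incompressible , B.incompressible ,
  _[ boundary ] , (λ t → ⟦ t ⟧ ends′) ,
  substitution-embedding boundary boundary-sound , evaluation-embedding ends′∼ends ends∼ends′ ,
  λ (η̄ , embedding , η̄∘ι≈η) → no-extension η̄ embedding (η̄∘ι≈η ∘ var)
  where
  module A = Generated ends
  module B = Generated (λ (_ : ⊤) → X)
  Bool-onto : ∀ v → ∃[ n ] (n ≡ᵇ 0) ≡ v
  Bool-onto true  = 0 , refl
  Bool-onto false = 1 , refl
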